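{- For every positive integer $n$, $|\mathrm{SAv}_n(132,231)|=n$.
   Context: Permutations $\pi\in S_n$ are identified with words $\pi(1)\cdots\pi(n)$. For $\tau\in S_m$, entries $\pi(i_1),\ldots,\pi(i_m)$ with $i_1<\cdots<i_m$ form an occurrence of $\tau$ if for all $j,l$, $\pi(i_j)<\pi(i_l)$ iff $\tau(j)<\tau(l)$; $\pi$ avoids $\tau$ if there is no occurrence. $\mathrm{SAv}_n(\tau_1,\ldots,\tau_r)$ is the set of $\pi\in S_n$ such that both $\pi$ and $\pi^2=\pi\circ\pi$ avoid each of $\tau_1,\ldots,\tau_r$. -}

module Defs where

open import Data.Nat using (ℕ; zero; suc)
open import Data.Fin using (Fin; _<_)
open import Data.Fin.Properties using (_<?_; _≟_; all?)
open import Data.Vec using (Vec; []; _∷_; lookup; tabulate)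
open import Data.List using (List; []; _∷_; concatMap; map; length; filter; allFin)
open import Data.Product using (_×_; _,_)
open import Relation.Nullary using (¬_; Dec)
open import Relation.Nullary.Decidable using (_×-dec_; _→-dec_; ¬?)
open import Relation.Binary.PropositionalEquality using (_≡_)
open import Data.List.Relation.Unary.Any using (Any; any?)

-- A permutation π ∈ S_n is represented by its word π(1)⋯π(n),
-- i.e. a vector w with w[i] = π(i) (positions and values 0-indexed).
Word : ℕ → Set
Word n = Vec (Fin n) n

allVecs : (n k : ℕ) → List (Vec (Fin n) k)
allVecs n zero = [] ∷ []
allVecs n (suc k) = concatMap (λ x → map (x ∷_) (allVecs n k)) (allFin n)

IsPerm : ∀ {n} → Word n → Set
IsPerm {n} w = ∀ (i j : Fin n) → lookup w i ≡ lookup w j → i ≡ j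

isPerm? : ∀ {n} (w : Word n) → Dec (IsPerm w)
isPerm? w = all? λ i → all? λ j → (lookup w i ≟ lookup w j) →-dec (i ≟ j)

square : ∀ {n} → Word n → Word n
square w = tabulate (λ i → lookup w (lookup w i))

Increasing : ∀ {n m} → Vec (Fin n) m → Set
Increasing {m = m} idx = ∀ (j l : Fin m) → j < l → lookup idx j < lookup idx l

increasing? : ∀ {n m} (idx : Vec (Fin n) m) → Dec (Increasing idx)
increasing? idx = all? λ j → all? λ l → (j <? l) →-dec (lookup idx j <? lookup idx l)

OrderIso : ∀ {n m} → Word n → Vec (Fin m) m → Vec (Fin n) m → Set
OrderIso {m = m} w τ idx =
  ∀ (j l : Fin m) → (lookup w (lookup idx j) < lookup w (lookup idx l) → lookup τ j < lookup τ l)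
                  × (lookup τ j < lookup τ l → lookup w (lookup idx j) < lookup w (lookup idx l))

orderIso? : ∀ {n m} (w : Word n) (τ : Vec (Fin m) m) (idx : Vec (Fin n) m) → Dec (OrderIso w τ idx)
orderIso? w τ idx = all? λ j → all? λ l →
  ((lookup w (lookup idx j) <? lookup w (lookup idx l)) →-dec (lookup τ j <? lookup τ l))
  ×-dec ((lookup τ j <? lookup τ l) →-dec (lookup w (lookup idx j) <? lookup w (lookup idx l)))

Occurrence : ∀ {n m} → Word n → Vec (Fin m) m → Vec (Fin n) m → Set
Occurrence w τ idx = Increasing idx × OrderIso w τ idx

occurrence? : ∀ {n m} (w : Word n) (τ : Vec (Fin m) m) (idx : Vec (Fin n) m) → Dec (Occurrence w τ idx)
occurrence? w τ idx = increasing? idx ×-dec orderIso? w τ idx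

Contains : ∀ {n m} → Word n → Vec (Fin m) m → Set
Contains {n} {m} w τ = Any (Occurrence w τ) (allVecs n m)

Avoids : ∀ {n m} → Word n → Vec (Fin m) m → Set
Avoids w τ = ¬ Contains w τ

avoids? : ∀ {n m} (w : Word n) (τ : Vec (Fin m) m) → Dec (Avoids w τ)
avoids? {n} {m} w τ = ¬? (any? (occurrence? w τ) (allVecs n m))

-- The patterns 132 and 231 as words in S_3 (0-indexed values: 021 and 120).
p132 : Vec (Fin 3) 3
p132 = Fin.zero ∷ Fin.suc (Fin.suc Fin.zero) ∷ Fin.suc Fin.zero ∷ []
  where import Data.Fin as Fin

p231 : Vec (Fin 3) 3
p231 = Fin.suc Fin.zero ∷ Fin.suc (Fin.suc Fin.zero) ∷ Fin.zero ∷ []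
  where import Data.Fin as Fin

InSAv : ∀ {n} → Word n → Set
InSAv w = IsPerm w × ((Avoids w p132 × Avoids w p231) × (Avoids (square w) p132 × Avoids (square w) p231))

inSAv? : ∀ {n} (w : Word n) → Dec (InSAv w)
inSAv? w = isPerm? w ×-dec ((avoids? w p132 ×-dec avoids? w p231) ×-dec (avoids? (square w) p132 ×-dec avoids? (square w) p231))

-- |SAv_n(132,231)|: number of words of length n over Fin n lying in SAv_n(132,231).
-- (allVecs n n lists every such word exactly once.)
countSAv : ℕ → ℕ
countSAv n = length (filter inSAv? (allVecs n n))

module Submission where

-- A permutation avoids both 132 and 231 exactly when it is peak-free: there are
-- no positions i < j < k with π(i) < π(j) > π(k).  So SAv_n(132,231) consists of
-- the permutations π with π and π² both peak-free.  We show these are exactly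
-- the n permutations  revPrefix a  (a = 0, …, n-1), which reverse the initial
-- segment [0,a] and fix every point above a.
--
-- These are involutions, so their squares are the identity and they lie in the
-- set.  Conversely, let T be the largest point moved by π.  Then π permutes
-- [0,T]; peak-freeness of π forces π(0) = T, peak-freeness of π² then forces
-- π(T) = 0, so π is strictly decreasing on [0,T] and hence π(i) = T - i there
-- (lemma countdown).

open import Defs
open import Data.Nat using (ℕ; _≤_)
open import Relation.Binary.PropositionalEquality using (_≡_)

open import Data.Nat using (zero; suc; _<_; _+_; _∸_; z≤n; z<s; s<s; _≤?_)
open import Data.Nat.Properties
  using ( ≤-refl; ≤-trans; ≤-reflexive; ≤-antisym; <⇒≤; ≤-<-trans; <-trans; <-irrefl; <-asym
        ; <-cmp; ≤-<-connex; <⇒≱; ≤∧≢⇒<; n≮0; n≢0⇒n>0; m≤n⇒m<n∨m≡n; m≤m+n; +-suc; +-identityʳ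
        ; +-monoˡ-≤; +-monoʳ-≤; m+n≤o⇒m≤o∸n; m+[n∸m]≡n; m∸n≤m; ∸-monoʳ-≤; m∸[m∸n]≡n
        ; module ≤-Reasoning )
open import Data.Nat.DivMod using (_mod_; m<n⇒m%n≡m)
open import Data.Fin using (Fin; zero; suc; toℕ; fromℕ<; punchOut)
open import Data.Fin.Properties
  using (toℕ-injective; toℕ<n; toℕ-fromℕ<; punchOut-injective; injective⇒≤; any?; _≟_)
open import Data.Vec using (Vec; []; _∷_; lookup; tabulate)
open import Data.Vec.Properties using (lookup∘tabulate; tabulate∘lookup; tabulate-cong; ∷-injectiveˡ; ∷-injectiveʳ)
open import Data.List using (List; map; length; filter; allFin)
open import Data.List.Properties using (length-map; length-tabulate)
open import Data.List.Relation.Unary.Any using (here; satisfied)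
import Data.List.Relation.Unary.Any as Any
import Data.List.Relation.Unary.All as All
import Data.List.Relation.Unary.All.Properties as All
import Data.List.Relation.Unary.AllPairs as AllPairs
import Data.List.Relation.Unary.AllPairs.Properties as AllPairs
open import Data.List.Relation.Unary.Unique.Propositional using (Unique)
import Data.List.Relation.Unary.Unique.Propositional.Properties as Unique
open import Data.List.Membership.Propositional using (_∈_)
open import Data.List.Membership.Propositional.Properties
  using (∈-map⁺; ∈-map⁻; ∈-concat⁺′; ∈-allFin; ∈-filter⁺; ∈-filter⁻)
open import Data.List.Membership.Propositional.Properties.WithK using (unique∧set⇒bag)
open import Data.List.Relation.Binary.BagAndSetEquality using (∼bag⇒↭)
open import Data.List.Relation.Binary.Permutation.Propositional.Properties using (↭-length)
open import Data.Product using (_×_; _,_; ∃; proj₁; proj₂)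
open import Data.Sum using (_⊎_; inj₁; inj₂)
open import Data.Empty using (⊥; ⊥-elim)
open import Function using (_∘_)
open import Function.Bundles using (mk⇔)
open import Relation.Nullary using (¬_; yes; no)
open import Relation.Unary using (Decidable)
open import Relation.Binary.PropositionalEquality using (refl; sym; trans; cong; subst; subst₂; _≢_; _≗_; module ≡-Reasoning)
open import Relation.Binary.Definitions using (tri<; tri≈; tri>)

allVecs-complete : ∀ n k (v : Vec (Fin n) k) → v ∈ allVecs n k
allVecs-complete n zero    []      = here refl
allVecs-complete n (suc k) (x ∷ v) =
  ∈-concat⁺′ (∈-map⁺ (x ∷_) (allVecs-complete n k v))
             (∈-map⁺ (λ y → map (y ∷_) (allVecs n k)) (∈-allFin x))

PeakFree : ∀ {n m} → (Fin n → Fin m) → Set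
PeakFree {n} g = ∀ (i j k : Fin n) → toℕ i < toℕ j → toℕ j < toℕ k →
                 toℕ (g i) < toℕ (g j) → toℕ (g k) < toℕ (g j) → ⊥

peakFree-resp : ∀ {n m} {g h : Fin n → Fin m} → g ≗ h → PeakFree g → PeakFree h
peakFree-resp g≗h g-pf i j k i<j j<k hi<hj hk<hj =
  g-pf i j k i<j j<k (subst₂ (λ x y → toℕ x < toℕ y) (sym (g≗h i)) (sym (g≗h j)) hi<hj)
                     (subst₂ (λ x y → toℕ x < toℕ y) (sym (g≗h k)) (sym (g≗h j)) hk<hj)

peakFree-id : ∀ {n} → PeakFree {n} (λ i → i)
peakFree-id i j k i<j j<k _ k<j = <-asym j<k k<j

data SameOrder {n m} (x y : Fin n) (u v : Fin m) : Set where
  both< : toℕ x < toℕ y → toℕ u < toℕ v → SameOrder x y u v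
  both> : toℕ y < toℕ x → toℕ v < toℕ u → SameOrder x y u v

sameOrder-swap : ∀ {n m} {x y : Fin n} {u v : Fin m} → SameOrder x y u v → SameOrder y x v u
sameOrder-swap (both< x<y u<v) = both> x<y u<v
sameOrder-swap (both> y<x v<u) = both< y<x v<u

sameOrder-agree : ∀ {n m} {x y : Fin n} {u v : Fin m} → SameOrder x y u v →
  (toℕ x < toℕ y → toℕ u < toℕ v) × (toℕ u < toℕ v → toℕ x < toℕ y)
sameOrder-agree (both< x<y u<v) = (λ _ → u<v) , (λ _ → x<y)
sameOrder-agree (both> y<x v<u) = (λ x<y → ⊥-elim (<-asym x<y y<x)) , (λ u<v → ⊥-elim (<-asym u<v v<u))

occurrence₃ : ∀ {n} (w : Word n) (τ : Vec (Fin 3) 3) {i j k : Fin n} →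
  toℕ i < toℕ j → toℕ j < toℕ k →
  SameOrder (lookup w i) (lookup w j) (lookup τ zero)       (lookup τ (suc zero)) →
  SameOrder (lookup w i) (lookup w k) (lookup τ zero)       (lookup τ (suc (suc zero))) →
  SameOrder (lookup w j) (lookup w k) (lookup τ (suc zero)) (lookup τ (suc (suc zero))) →
  Contains w τ
occurrence₃ {n} w τ {i} {j} {k} i<j j<k s₀₁ s₀₂ s₁₂ =
  Any.map (λ { refl → increasing , orderIso }) (allVecs-complete n 3 (i ∷ j ∷ k ∷ []))
  where
    increasing : Increasing (i ∷ j ∷ k ∷ [])
    increasing zero             (suc zero)       _ = i<j
    increasing zero             (suc (suc zero)) _ = <-trans i<j j<k
    increasing (suc zero)       (suc (suc zero)) _ = j<k
    increasing zero             zero             ()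
    increasing (suc zero)       zero             ()
    increasing (suc zero)       (suc zero)       (s<s ())
    increasing (suc (suc zero)) zero             ()
    increasing (suc (suc zero)) (suc zero)       (s<s ())
    increasing (suc (suc zero)) (suc (suc zero)) (s<s (s<s ()))
    irreflexive : ∀ {A B : Set} (a b : ℕ) → (a < a → A) × (b < b → B)
    irreflexive a b = (λ a<a → ⊥-elim (<-irrefl refl a<a)) , (λ b<b → ⊥-elim (<-irrefl refl b<b))
    orderIso : OrderIso w τ (i ∷ j ∷ k ∷ [])
    orderIso zero             zero             = irreflexive _ _
    orderIso zero             (suc zero)       = sameOrder-agree s₀₁
    orderIso zero             (suc (suc zero)) = sameOrder-agree s₀₂
    orderIso (suc zero)       zero             = sameOrder-agree (sameOrder-swap s₀₁)
    orderIso (suc zero)       (suc zero)       = irreflexive _ _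
    orderIso (suc zero)       (suc (suc zero)) = sameOrder-agree s₁₂
    orderIso (suc (suc zero)) zero             = sameOrder-agree (sameOrder-swap s₀₂)
    orderIso (suc (suc zero)) (suc zero)       = sameOrder-agree (sameOrder-swap s₁₂)
    orderIso (suc (suc zero)) (suc (suc zero)) = irreflexive _ _

peakFree⇒avoids : ∀ {n} (w : Word n) (τ : Vec (Fin 3) 3) →
  toℕ (lookup τ zero) < toℕ (lookup τ (suc zero)) →
  toℕ (lookup τ (suc (suc zero))) < toℕ (lookup τ (suc zero)) →
  PeakFree (lookup w) → Avoids w τ
peakFree⇒avoids w τ τ₀<τ₁ τ₂<τ₁ w-pf occurs with idx , (increasing , orderIso) ← satisfied occurs =
  w-pf (lookup idx zero) (lookup idx (suc zero)) (lookup idx (suc (suc zero)))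
       (increasing zero (suc zero) z<s) (increasing (suc zero) (suc (suc zero)) (s<s z<s))
       (proj₂ (orderIso zero (suc zero)) τ₀<τ₁) (proj₂ (orderIso (suc (suc zero)) (suc zero)) τ₂<τ₁)

-- A peak of a permutation is an occurrence of 132 or of 231, according to how the two
-- outer entries compare.
avoids⇒peakFree : ∀ {n} (w : Word n) → IsPerm w → Avoids w p132 → Avoids w p231 → PeakFree (lookup w)
avoids⇒peakFree w w-perm avoids132 avoids231 i j k i<j j<k wi<wj wk<wj
  with <-cmp (toℕ (lookup w i)) (toℕ (lookup w k))
... | tri< wi<wk _ _ = avoids132 (occurrence₃ w p132 i<j j<k (both< wi<wj z<s) (both< wi<wk z<s) (both> wk<wj (s<s z<s)))
... | tri> _ _ wk<wi = avoids231 (occurrence₃ w p231 i<j j<k (both< wi<wj (s<s z<s)) (both> wk<wi z<s) (both> wk<wj z<s))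
... | tri≈ _ wi≡wk _ = <-irrefl (cong toℕ (w-perm i k (toℕ-injective wi≡wk))) (<-trans i<j j<k)

square-lookup : ∀ {n} (w : Word n) → lookup (square w) ≗ λ i → lookup w (lookup w i)
square-lookup w = lookup∘tabulate (λ i → lookup w (lookup w i))

square-perm : ∀ {n} (w : Word n) → IsPerm w → IsPerm (square w)
square-perm w w-perm i j e =
  w-perm i j (w-perm _ _ (trans (sym (square-lookup w i)) (trans e (square-lookup w j))))

revPrefix : ∀ {n} → Fin n → Fin n → Fin n
revPrefix a i with toℕ i ≤? toℕ a
... | yes _ = fromℕ< (≤-<-trans (m∸n≤m (toℕ a) (toℕ i)) (toℕ<n a))
... | no  _ = i

revPrefix-≤ : ∀ {n} (a i : Fin n) → toℕ i ≤ toℕ a → toℕ (revPrefix a i) ≡ toℕ a ∸ toℕ i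
revPrefix-≤ a i i≤a with toℕ i ≤? toℕ a
... | yes _   = toℕ-fromℕ< _
... | no  i≰a = ⊥-elim (i≰a i≤a)

revPrefix-> : ∀ {n} (a i : Fin n) → toℕ a < toℕ i → revPrefix a i ≡ i
revPrefix-> a i a<i with toℕ i ≤? toℕ a
... | yes i≤a = ⊥-elim (<⇒≱ a<i i≤a)
... | no  _   = refl

revPrefix-zero : ∀ {n} (i : Fin (suc n)) → revPrefix zero i ≡ i
revPrefix-zero {n} zero = toℕ-injective (revPrefix-≤ {suc n} zero zero z≤n)
revPrefix-zero (suc i)  = revPrefix-> zero (suc i) z<s

revPrefix-involutive : ∀ {n} (a i : Fin n) → revPrefix a (revPrefix a i) ≡ i
revPrefix-involutive a i with ≤-<-connex (toℕ i) (toℕ a)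
... | inj₂ a<i = trans (cong (revPrefix a) (revPrefix-> a i a<i)) (revPrefix-> a i a<i)
... | inj₁ i≤a = toℕ-injective (begin
    toℕ (revPrefix a (revPrefix a i)) ≡⟨ revPrefix-≤ a (revPrefix a i) ri≤a ⟩
    toℕ a ∸ toℕ (revPrefix a i)       ≡⟨ cong (toℕ a ∸_) (revPrefix-≤ a i i≤a) ⟩
    toℕ a ∸ (toℕ a ∸ toℕ i)           ≡⟨ m∸[m∸n]≡n i≤a ⟩
    toℕ i                             ∎)
  where
    open ≡-Reasoning
    ri≤a : toℕ (revPrefix a i) ≤ toℕ a
    ri≤a = subst (_≤ toℕ a) (sym (revPrefix-≤ a i i≤a)) (m∸n≤m (toℕ a) (toℕ i))

revPrefix-injective : ∀ {n} (a : Fin n) (i j : Fin n) → revPrefix a i ≡ revPrefix a j → i ≡ j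
revPrefix-injective a i j e =
  trans (sym (revPrefix-involutive a i)) (trans (cong (revPrefix a) e) (revPrefix-involutive a j))

-- A peak at j is impossible: below a the map is decreasing, above a it is the identity.
revPrefix-peakFree : ∀ {n} (a : Fin n) → PeakFree (revPrefix a)
revPrefix-peakFree a i j k i<j j<k ri<rj rk<rj with ≤-<-connex (toℕ j) (toℕ a)
... | inj₁ j≤a = <⇒≱ (subst₂ _<_ (revPrefix-≤ a i (≤-trans (<⇒≤ i<j) j≤a)) (revPrefix-≤ a j j≤a) ri<rj)
                    (∸-monoʳ-≤ (toℕ a) (<⇒≤ i<j))
... | inj₂ a<j = <-asym j<k (subst₂ (λ x y → toℕ x < toℕ y) (revPrefix-> a k (<-trans a<j j<k))
                                                           (revPrefix-> a j a<j) rk<rj)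

revWord : ∀ {n} → Fin n → Word n
revWord a = tabulate (revPrefix a)

-- Distinct a give distinct words: the first entry of revWord a is a.
revWord-injective : ∀ {m} {a b : Fin (suc m)} → revWord a ≡ revWord b → a ≡ b
revWord-injective {a = a} {b} e = toℕ-injective (begin
  toℕ a                         ≡⟨ revPrefix-≤ a zero z≤n ⟨
  toℕ (revPrefix a zero)        ≡⟨ cong toℕ (lookup∘tabulate (revPrefix a) zero) ⟨
  toℕ (lookup (revWord a) zero) ≡⟨ cong (λ w → toℕ (lookup w zero)) e ⟩
  toℕ (lookup (revWord b) zero) ≡⟨ cong toℕ (lookup∘tabulate (revPrefix b) zero) ⟩
  toℕ (revPrefix b zero)        ≡⟨ revPrefix-≤ b zero z≤n ⟩
  toℕ b                         ∎)
  where open ≡-Reasoning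

-- revWord a is a peak-free involution, so it and its square (the identity) avoid 132 and 231.
revWord-inSAv : ∀ {n} (a : Fin n) → InSAv (revWord a)
revWord-inSAv {n} a =
  w-perm , (peakFree⇒avoids w p132 z<s (s<s z<s) w-pf , peakFree⇒avoids w p231 (s<s z<s) z<s w-pf)
         , (peakFree⇒avoids (square w) p132 z<s (s<s z<s) w²-pf , peakFree⇒avoids (square w) p231 (s<s z<s) z<s w²-pf)
  where
    w : Word n
    w = revWord a
    lookup-w : lookup w ≗ revPrefix a
    lookup-w = lookup∘tabulate (revPrefix a)
    w-perm : IsPerm w
    w-perm i j e = revPrefix-injective a i j (trans (sym (lookup-w i)) (trans e (lookup-w j)))
    w-pf : PeakFree (lookup w)
    w-pf = peakFree-resp (sym ∘ lookup-w) (revPrefix-peakFree a)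
    square-id : ∀ i → lookup (square w) i ≡ i
    square-id i = begin
      lookup (square w) i             ≡⟨ square-lookup w i ⟩
      lookup w (lookup w i)           ≡⟨ lookup-w (lookup w i) ⟩
      revPrefix a (lookup w i)        ≡⟨ cong (revPrefix a) (lookup-w i) ⟩
      revPrefix a (revPrefix a i)     ≡⟨ revPrefix-involutive a i ⟩
      i                               ∎
      where open ≡-Reasoning
    w²-pf : PeakFree (lookup (square w))
    w²-pf = peakFree-resp (sym ∘ square-id) peakFree-id

countdown : (h : ℕ → ℕ) (t : ℕ) → (∀ k → suc k ≤ t → h (suc k) < h k) → h 0 ≤ t →
            ∀ k → k ≤ t → h k ≡ t ∸ k
countdown h t h-dec h0≤t k k≤t =
  ≤-antisym (m+n≤o⇒m≤o∸n (h k) (upper k k≤t))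
            (≤-trans (m≤m+n (t ∸ k) _) (lower (t ∸ k) k (≤-reflexive (m+[n∸m]≡n k≤t))))
  where
    open ≤-Reasoning
    upper : ∀ k → k ≤ t → h k + k ≤ t
    upper zero    _    = ≤-trans (≤-reflexive (+-identityʳ (h 0))) h0≤t
    upper (suc k) k<t = begin
      h (suc k) + suc k    ≡⟨ +-suc (h (suc k)) k ⟩
      suc (h (suc k)) + k  ≤⟨ +-monoˡ-≤ k (h-dec k k<t) ⟩
      h k + k              ≤⟨ upper k (<⇒≤ k<t) ⟩
      t                    ∎
    lower : ∀ j k → k + j ≤ t → j + h (k + j) ≤ h k
    lower zero    k _      = ≤-reflexive (cong h (+-identityʳ k))
    lower (suc j) k k+j<t′ = begin
      suc j + h (k + suc j)     ≡⟨ cong (λ x → suc j + h x) (+-suc k j) ⟩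
      suc j + h (suc (k + j))   ≡⟨ +-suc j _ ⟨
      j + suc (h (suc (k + j))) ≤⟨ +-monoʳ-≤ j (h-dec (k + j) k+j<t) ⟩
      j + h (k + j)             ≤⟨ lower j k (<⇒≤ k+j<t) ⟩
      h k                       ∎
      where
        k+j<t : suc (k + j) ≤ t
        k+j<t = subst (_≤ t) (+-suc k j) k+j<t′

-- An injective endomap of a finite set is surjective: a missed value would give an
-- injection Fin n → Fin (n - 1).
injective⇒surjective : ∀ {n} (f : Fin n → Fin n) → (∀ i j → f i ≡ f j → i ≡ j) → ∀ y → ∃ λ x → f x ≡ y
injective⇒surjective {zero}  f _          ()
injective⇒surjective {suc n} f f-injective y with any? (λ x → f x ≟ y)
... | yes hit  = hit
... | no  miss = ⊥-elim (<-irrefl refl (injective⇒≤ squeezed-injective))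
  where
    squeezed : Fin (suc n) → Fin n
    squeezed x = punchOut {i = y} {j = f x} (λ y≡fx → miss (x , sym y≡fx))
    squeezed-injective : ∀ {x z} → squeezed x ≡ squeezed z → x ≡ z
    squeezed-injective {x} {z} e =
      f-injective x z (punchOut-injective (λ y≡fx → miss (x , sym y≡fx)) (λ y≡fz → miss (z , sym y≡fz)) e)

toℕ-mod : ∀ {n} k → k < suc n → toℕ (k mod suc n) ≡ k
toℕ-mod k k<n = trans (toℕ-fromℕ< _) (m<n⇒m%n≡m k<n)

module Characterisation {m : ℕ} (π : Fin (suc m) → Fin (suc m))
  (π-injective : ∀ i j → π i ≡ π j → i ≡ j)
  (π-peakFree : PeakFree π) (π²-peakFree : PeakFree (λ i → π (π i))) where

  module AboveFixed (T : Fin (suc m)) (fixedAbove : ∀ i → toℕ T < toℕ i → π i ≡ i) where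

    -- π maps [0,T] into [0,T]: points above T are already the images of themselves.
    maps-into : ∀ i → toℕ i ≤ toℕ T → toℕ (π i) ≤ toℕ T
    maps-into i i≤T with ≤-<-connex (toℕ (π i)) (toℕ T)
    ... | inj₁ πi≤T = πi≤T
    ... | inj₂ T<πi = ⊥-elim (<⇒≱ T<πi (subst (λ x → toℕ x ≤ toℕ T) (sym πi≡i) i≤T))
      where
        πi≡i : π i ≡ i
        πi≡i = π-injective (π i) i (fixedAbove (π i) T<πi)

    comes-from : ∀ p → toℕ (π p) ≤ toℕ T → toℕ p ≤ toℕ T
    comes-from p πp≤T with ≤-<-connex (toℕ p) (toℕ T)
    ... | inj₁ p≤T = p≤T
    ... | inj₂ T<p = ⊥-elim (<⇒≱ T<p (subst (λ x → toℕ x ≤ toℕ T) (fixedAbove p T<p) πp≤T))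

    below-T : ∀ p → π p ≡ T → ∀ i → toℕ i ≤ toℕ T → i ≢ p → toℕ (π i) < toℕ T
    below-T p πp≡T i i≤T i≢p = ≤∧≢⇒< (maps-into i i≤T)
      (λ πi≡T → i≢p (π-injective i p (toℕ-injective (trans πi≡T (cong toℕ (sym πp≡T))))))

    -- The preimage of T is T itself or 0: an interior preimage would be a peak of π.
    preimage-at-start : ∀ p → π p ≡ T → p ≢ T → p ≡ zero
    preimage-at-start zero    _    _   = refl
    preimage-at-start (suc p) πp≡T p≢T =
      ⊥-elim (π-peakFree zero (suc p) T z<s p<T (below-πp zero z≤n (λ ())) (below-πp T ≤-refl (p≢T ∘ sym)))
      where
        p<T : toℕ (suc p) < toℕ T
        p<T = ≤∧≢⇒< (comes-from (suc p) (≤-reflexive (cong toℕ πp≡T))) (p≢T ∘ toℕ-injective)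
        below-πp : ∀ i → toℕ i ≤ toℕ T → i ≢ suc p → toℕ (π i) < toℕ (π (suc p))
        below-πp i i≤T i≢p = subst (λ x → toℕ (π i) < toℕ x) (sym πp≡T) (below-T (suc p) πp≡T i i≤T i≢p)

    module StartsAtT (π0≡T : π zero ≡ T) (0≢T : zero ≢ T) where

      πT<T : toℕ (π T) < toℕ T
      πT<T = below-T zero π0≡T T ≤-refl (0≢T ∘ sym)

      -- π T = 0: otherwise the preimage q of 0 lies strictly inside (0,T), and
      -- π²(0) = π T < T = π²(q) > π²(T) makes q a peak of π².
      πT≡0 : π T ≡ zero
      πT≡0 with injective⇒surjective π π-injective zero
      ... | q , πq≡0 with q ≟ T
      ...   | yes refl = πq≡0
      ...   | no  q≢T  = ⊥-elim (π²-peakFree zero q T 0<q q<T π²0<π²q π²T<π²q)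
        where
          π²q≡T : π (π q) ≡ T
          π²q≡T = trans (cong π πq≡0) π0≡T
          q≢0 : q ≢ zero
          q≢0 refl = 0≢T (trans (sym πq≡0) π0≡T)
          0<q : 0 < toℕ q
          0<q = n≢0⇒n>0 (q≢0 ∘ toℕ-injective {j = zero})
          q<T : toℕ q < toℕ T
          q<T = ≤∧≢⇒< (comes-from q (subst (λ x → toℕ x ≤ toℕ T) (sym πq≡0) z≤n)) (q≢T ∘ toℕ-injective)
          π²0<π²q : toℕ (π (π zero)) < toℕ (π (π q))
          π²0<π²q = subst₂ (λ x y → toℕ x < toℕ y) (sym (cong π π0≡T)) (sym π²q≡T) πT<T
          πT≢0 : π T ≢ zero
          πT≢0 πT≡0 = q≢T (π-injective q T (trans πq≡0 (sym πT≡0)))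
          π²T<π²q : toℕ (π (π T)) < toℕ (π (π q))
          π²T<π²q = subst (λ x → toℕ (π (π T)) < toℕ x) (sym π²q≡T) (below-T zero π0≡T (π T) (<⇒≤ πT<T) πT≢0)

      -- π is strictly decreasing on [0,T]: an ascent π i < π j with j < T would form
      -- a peak with π T = 0.
      decreasing : ∀ i j → toℕ i < toℕ j → toℕ j ≤ toℕ T → toℕ (π j) < toℕ (π i)
      decreasing i j i<j j≤T with <-cmp (toℕ (π i)) (toℕ (π j))
      ... | tri> _ _ πj<πi = πj<πi
      ... | tri≈ _ πi≡πj _ = ⊥-elim (<-irrefl (cong toℕ (π-injective i j (toℕ-injective πi≡πj))) i<j)
      ... | tri< πi<πj _ _ = ⊥-elim (π-peakFree i j T i<j j<T πi<πj πT<πj)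
        where
          πT<πj : toℕ (π T) < toℕ (π j)
          πT<πj = subst (λ x → toℕ x < toℕ (π j)) (sym πT≡0) (≤-<-trans z≤n πi<πj)
          j≢T : toℕ j ≢ toℕ T
          j≢T j≡T = n≮0 (subst (λ x → toℕ (π i) < toℕ x) (trans (cong π (toℕ-injective j≡T)) πT≡0) πi<πj)
          j<T : toℕ j < toℕ T
          j<T = ≤∧≢⇒< j≤T j≢T

      -- By countdown, the decreasing values π 0, …, π T in [0,T] are exactly T, …, 0.
      reversed-below : ∀ i → toℕ i ≤ toℕ T → toℕ (π i) ≡ toℕ T ∸ toℕ i
      reversed-below i i≤T =
        subst (λ x → toℕ (π x) ≡ toℕ T ∸ toℕ i) (toℕ-injective (toℕ-mod (toℕ i) (toℕ<n i)))
              (countdown h (toℕ T) h-dec h0≤T (toℕ i) i≤T)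
        where
          h : ℕ → ℕ
          h k = toℕ (π (k mod suc m))
          h-dec : ∀ k → suc k ≤ toℕ T → h (suc k) < h k
          h-dec k k<T = decreasing (k mod suc m) (suc k mod suc m)
            (subst₂ _<_ (sym (toℕ-mod k k<n)) (sym (toℕ-mod (suc k) k+1<n)) ≤-refl)
            (subst (_≤ toℕ T) (sym (toℕ-mod (suc k) k+1<n)) k<T)
            where
              k+1<n : suc k < suc m
              k+1<n = ≤-<-trans k<T (toℕ<n T)
              k<n : k < suc m
              k<n = <⇒≤ k+1<n
          h0≤T : h 0 ≤ toℕ T
          h0≤T = maps-into (0 mod suc m) (subst (_≤ toℕ T) (sym (toℕ-mod {m} 0 z<s)) z≤n)

      reversed : π ≗ revPrefix T
      reversed i with ≤-<-connex (toℕ i) (toℕ T)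
      ... | inj₁ i≤T = toℕ-injective (trans (reversed-below i i≤T) (sym (revPrefix-≤ T i i≤T)))
      ... | inj₂ T<i = trans (fixedAbove i T<i) (sym (revPrefix-> T i T<i))

    fixed-or-reversed : π T ≡ T ⊎ π ≗ revPrefix T
    fixed-or-reversed with injective⇒surjective π π-injective T
    ... | p , πp≡T with p ≟ T
    ...   | yes refl = inj₁ πp≡T
    ...   | no  p≢T with preimage-at-start p πp≡T p≢T
    ...     | refl = inj₂ (StartsAtT.reversed πp≡T p≢T)

  -- Descending induction on a threshold t such that π fixes every point ≥ t.
  descend : ∀ t → t ≤ suc m → (∀ i → t ≤ toℕ i → π i ≡ i) → ∃ λ a → π ≗ revPrefix a
  descend zero    _   fixed = zero , λ i → trans (fixed i z≤n) (sym (revPrefix-zero i))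
  descend (suc t) t<n fixed with AboveFixed.fixed-or-reversed T fixedAbove
    where
      T : Fin (suc m)
      T = fromℕ< t<n
      fixedAbove : ∀ i → toℕ T < toℕ i → π i ≡ i
      fixedAbove i T<i = fixed i (subst (λ x → suc x ≤ toℕ i) (toℕ-fromℕ< t<n) T<i)
  ... | inj₂ π≗rev = fromℕ< t<n , π≗rev
  ... | inj₁ πT≡T  = descend t (<⇒≤ t<n) fixedFromT
    where
      fixedFromT : ∀ i → t ≤ toℕ i → π i ≡ i
      fixedFromT i t≤i with m≤n⇒m<n∨m≡n t≤i
      ... | inj₁ t<i = fixed i t<i
      ... | inj₂ t≡i = subst (λ x → π x ≡ x) (toℕ-injective (trans (toℕ-fromℕ< t<n) t≡i)) πT≡T

  characterise : ∃ λ a → π ≗ revPrefix a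
  characterise = descend (suc m) ≤-refl (λ i n≤i → ⊥-elim (<⇒≱ (toℕ<n i) n≤i))

-- allVecs n k lists each vector only once: the blocks for different heads are disjoint.
allVecs-unique : ∀ n k → Unique (allVecs n k)
allVecs-unique n zero    = All.[] AllPairs.∷ AllPairs.[]
allVecs-unique n (suc k) =
  Unique.concat⁺ (All.map⁺ (All.tabulate (λ _ → Unique.map⁺ ∷-injectiveʳ (allVecs-unique n k))))
                 (AllPairs.map⁺ (AllPairs.map disjoint (Unique.allFin⁺ n)))
  where
    disjoint : ∀ {x y} → x ≢ y → ∀ {v} → ¬ (v ∈ map (x ∷_) (allVecs n k) × v ∈ map (y ∷_) (allVecs n k))
    disjoint x≢y (v∈x , v∈y) with ∈-map⁻ _ v∈x | ∈-map⁻ _ v∈y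
    ... | _ , _ , refl | _ , _ , x∷u≡y∷u′ = x≢y (∷-injectiveˡ x∷u≡y∷u′)

length-filter-image : ∀ {A : Set} {P : A → Set} (P? : Decidable P) {k} (f : Fin k → A) {xs : List A} →
  Unique xs → (∀ x → x ∈ xs) → (∀ {i j} → f i ≡ f j → i ≡ j) →
  (∀ i → P (f i)) → (∀ x → P x → ∃ λ i → x ≡ f i) → length (filter P? xs) ≡ k
length-filter-image P? {k} f {xs} xs-unique xs-complete f-injective P-image image-P =
  begin
    length (filter P? xs)       ≡⟨ ↭-length (∼bag⇒↭ (unique∧set⇒bag filtered-unique image-unique (mk⇔ to from))) ⟩
    length (map f (allFin k))   ≡⟨ length-map f (allFin k) ⟩
    length (allFin k)           ≡⟨ length-tabulate (λ i → i) ⟩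
    k                           ∎
  where
    open ≡-Reasoning
    filtered-unique : Unique (filter P? xs)
    filtered-unique = Unique.filter⁺ P? xs-unique
    image-unique : Unique (map f (allFin k))
    image-unique = Unique.map⁺ f-injective (Unique.allFin⁺ k)
    to : ∀ {x} → x ∈ filter P? xs → x ∈ map f (allFin k)
    to {x} x∈ with i , x≡fi ← image-P x (proj₂ (∈-filter⁻ P? {xs = xs} x∈)) =
      subst (_∈ map f (allFin k)) (sym x≡fi) (∈-map⁺ f (∈-allFin i))
    from : ∀ {x} → x ∈ map f (allFin k) → x ∈ filter P? xs
    from x∈ with i , _ , x≡fi ← ∈-map⁻ f x∈ =
      subst (_∈ filter P? xs) (sym x≡fi) (∈-filter⁺ P? (xs-complete (f i)) (P-image i))

inSAv⇒peakFree : ∀ {n} (w : Word n) → InSAv w → PeakFree (lookup w) × PeakFree (λ i → lookup w (lookup w i))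
inSAv⇒peakFree w (w-perm , (avoids132 , avoids231) , (w²-avoids132 , w²-avoids231)) =
  avoids⇒peakFree w w-perm avoids132 avoids231 ,
  peakFree-resp (square-lookup w) (avoids⇒peakFree (square w) (square-perm w w-perm) w²-avoids132 w²-avoids231)

inSAv⇒revWord : ∀ {m} (w : Word (suc m)) → InSAv w → ∃ λ a → w ≡ revWord a
inSAv⇒revWord w w∈SAv
  with w-pf , w²-pf ← inSAv⇒peakFree w w∈SAv
  with a , w≗rev ← Characterisation.characterise (lookup w) (proj₁ w∈SAv) w-pf w²-pf =
  a , (begin
    w                     ≡⟨ tabulate∘lookup w ⟨
    tabulate (lookup w)   ≡⟨ tabulate-cong w≗rev ⟩
    revWord a             ∎)
  where open ≡-Reasoning

corollary5p1 : (n : ℕ) → 1 ≤ n → countSAv n ≡ n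
corollary5p1 (suc m) _ =
  length-filter-image inSAv? revWord (allVecs-unique (suc m) (suc m)) (allVecs-complete (suc m) (suc m))
                      revWord-injective revWord-inSAv (inSAv⇒revWord {m})
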